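{- For nonnegative integers $u,d$ let $$\mathbf{Q}^u_d(y)=\sum_{k=0}^{d}\binom{d}{k}\prod_{i=0}^{k-1}(i+1-r)(i+r)\prod_{i=k+1}^{d}(y+d+r-i)(y+u+r+i)$$ and for nonnegative integers $k$ let $\phi_k(y)=\prod_{i=1}^{k}(y+i)(y+i-1+2r)$. Then for all nonnegative integers $u,d$, $$\mathbf{Q}^u_d(y)\,\phi_u(y)=\mathbf{Q}^d_u(y)\,\phi_d(y).$$
   Context: $y$ and $r$ are indeterminates; the identity is a polynomial identity in $y,r$. -}

module Defs where

open import Level using (Level)
open import Data.Nat using (ℕ; zero; suc; _∸_) renaming (_+_ to _+ℕ_)
open import Data.Nat.Combinatorics using (_C_)
open import Algebra.Bundles using (CommutativeRing)

module _ {c ℓ : Level} (R : CommutativeRing c ℓ) where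
  open CommutativeRing R

  ι : ℕ → Carrier
  ι zero    = 0#
  ι (suc n) = 1# + ι n

  prodFrom : ℕ → ℕ → (ℕ → Carrier) → Carrier
  prodFrom a zero    f = 1#
  prodFrom a (suc n) f = f a * prodFrom (suc a) n f

  -- ∏_{i=a}^{b} f i  (empty, i.e. 1#, when b < a)
  prodIcc : ℕ → ℕ → (ℕ → Carrier) → Carrier
  prodIcc a b f = prodFrom a (suc b ∸ a) f

  sumUpTo : ℕ → (ℕ → Carrier) → Carrier
  sumUpTo zero    g = g 0
  sumUpTo (suc d) g = sumUpTo d g + g (suc d)

  Q : ℕ → ℕ → Carrier → Carrier → Carrier
  Q u d y r =
    sumUpTo d (λ k →
      ι (d C k)
      * prodFrom 0 k (λ i → (ι (suc i) - r) * (ι i + r))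
      * prodIcc (suc k) d (λ i → ((y + ι d) + r - ι i) * ((y + ι u) + r + ι i)))

  φ : ℕ → Carrier → Carrier → Carrier
  φ k y r = prodIcc 1 k (λ i → (y + ι i) * ((y + ι (i ∸ 1)) + (r + r)))

-- Put a = y + r, p = 1 - r, q = r and b = a + u + p + q. With rising factorials (x)ₙ, the k-th
-- summand of Q^u_d(y) is C(d,k) (p)ₖ (q)ₖ (a)ₘ (b+k)ₘ with m = d - k, and φ_u(y) = (a+p)ᵤ (a+q)ᵤ.
-- For arbitrary p, q, a let T(u,d;a) be the product of these two, and ψₙ(a) = (a+p+n)(a+q+n).
-- A contiguous relation in b (absorption of binomial coefficients) and a three-term recurrence
-- in d (Pascal's rule, up to a telescoping correction) give
--   T(u+1,d+1;a) = ψᵤ(a) T(u,d+1;a) + (d+1) a (a+p)(a+q) T(u,d;a+1)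
--                = ψ_d(a) T(u+1,d;a) + (u+1) a (a+p)(a+q) T(u,d;a+1),
-- and these two expansions are exchanged by u ↔ d, so T is symmetric by induction on u and d.

module Submission where

open import Defs
open import Level using (Level)
open import Data.Nat using (ℕ; zero; suc; _!)
import Data.Nat as ℕ
import Data.Nat.Properties as ℕ
open import Data.Nat.Properties using (_!*_!≢0)
open import Data.Nat.Combinatorics using (_C_; nCn≡1; nCk+nC[k+1]≡[n+1]C[k+1])
open import Data.Nat.Solver using (module +-*-Solver)
open import Algebra.Bundles using (CommutativeRing)
open import Relation.Binary.PropositionalEquality as ≡ using (_≡_)

module _ where
  open ≡ using (refl; sym; trans; cong; cong₂; module ≡-Reasoning)

  binom : ℕ → ℕ → ℕ
  binom zero    m       = 1
  binom (suc k) zero    = 1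
  binom (suc k) (suc m) = binom k (suc m) ℕ.+ binom (suc k) m

  binom-zeroʳ : ∀ k → binom k 0 ≡ 1
  binom-zeroʳ zero    = refl
  binom-zeroʳ (suc k) = refl

  binom≡C : ∀ k m → binom k m ≡ (k ℕ.+ m) C k
  binom≡C zero    m       = refl
  binom≡C (suc k) zero    = sym (trans (cong (_C suc k) (ℕ.+-identityʳ (suc k))) (nCn≡1 (suc k)))
  binom≡C (suc k) (suc m) = begin
    binom k (suc m) ℕ.+ binom (suc k) m        ≡⟨ cong₂ ℕ._+_ (binom≡C k (suc m)) (binom≡C (suc k) m) ⟩
    n C k ℕ.+ suc (k ℕ.+ m) C suc k            ≡⟨ cong (λ j → n C k ℕ.+ j C suc k) (ℕ.+-suc k m) ⟨
    n C k ℕ.+ n C suc k                        ≡⟨ nCk+nC[k+1]≡[n+1]C[k+1] n k ⟩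
    suc n C suc k                              ∎
    where
    open ≡-Reasoning
    n = k ℕ.+ suc m

  binom-*-factorials : ∀ k m → binom k m ℕ.* (k ! ℕ.* m !) ≡ (k ℕ.+ m) !
  binom-*-factorials zero    m       = trans (ℕ.+-identityʳ _) (ℕ.+-identityʳ _)
  binom-*-factorials (suc k) zero    =
    trans (ℕ.+-identityʳ _) (trans (ℕ.*-identityʳ _) (cong _! (sym (ℕ.+-identityʳ (suc k)))))
  binom-*-factorials (suc k) (suc m) = begin
    (binom k (suc m) ℕ.+ binom (suc k) m) ℕ.* (suc k ! ℕ.* suc m !)
      ≡⟨ solve 6 (λ x y k m k! m! →
              (x :+ y) :* ((con 1 :+ k) :* k! :* ((con 1 :+ m) :* m!))
           := (con 1 :+ k) :* (x :* (k! :* ((con 1 :+ m) :* m!)))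
              :+ (con 1 :+ m) :* (y :* ((con 1 :+ k) :* k! :* m!)))
           refl (binom k (suc m)) (binom (suc k) m) k m (k !) (m !) ⟩
    suc k ℕ.* (binom k (suc m) ℕ.* (k ! ℕ.* suc m !)) ℕ.+ suc m ℕ.* (binom (suc k) m ℕ.* (suc k ! ℕ.* m !))
      ≡⟨ cong₂ (λ x y → suc k ℕ.* x ℕ.+ suc m ℕ.* y)
               (binom-*-factorials k (suc m)) (binom-*-factorials (suc k) m) ⟩
    suc k ℕ.* (k ℕ.+ suc m) ! ℕ.+ suc m ℕ.* suc (k ℕ.+ m) !
      ≡⟨ cong (λ j → suc k ℕ.* (k ℕ.+ suc m) ! ℕ.+ suc m ℕ.* j !) (ℕ.+-suc k m) ⟨
    suc k ℕ.* (k ℕ.+ suc m) ! ℕ.+ suc m ℕ.* (k ℕ.+ suc m) !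
      ≡⟨ ℕ.*-distribʳ-+ ((k ℕ.+ suc m) !) (suc k) (suc m) ⟨
    suc (k ℕ.+ suc m) ! ∎
    where
    open ≡-Reasoning
    open +-*-Solver

  binom-absorbˡ : ∀ k m → suc k ℕ.* binom (suc k) m ≡ suc (k ℕ.+ m) ℕ.* binom k m
  binom-absorbˡ k m = ℕ.*-cancelʳ-≡ _ _ (k ! ℕ.* m !) {{k !* m !≢0}} (begin
    suc k ℕ.* binom (suc k) m ℕ.* (k ! ℕ.* m !)
      ≡⟨ solve 4 (λ k′ b k! m! → k′ :* b :* (k! :* m!) := b :* (k′ :* k! :* m!))
               refl (suc k) (binom (suc k) m) (k !) (m !) ⟩
    binom (suc k) m ℕ.* (suc k ! ℕ.* m !)            ≡⟨ binom-*-factorials (suc k) m ⟩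
    suc (k ℕ.+ m) ℕ.* (k ℕ.+ m) !                    ≡⟨ cong (suc (k ℕ.+ m) ℕ.*_) (binom-*-factorials k m) ⟨
    suc (k ℕ.+ m) ℕ.* (binom k m ℕ.* (k ! ℕ.* m !))  ≡⟨ ℕ.*-assoc (suc (k ℕ.+ m)) (binom k m) _ ⟨
    suc (k ℕ.+ m) ℕ.* binom k m ℕ.* (k ! ℕ.* m !)    ∎)
    where
    open ≡-Reasoning
    open +-*-Solver

  binom-absorbʳ : ∀ k m → suc m ℕ.* binom k (suc m) ≡ suc (k ℕ.+ m) ℕ.* binom k m
  binom-absorbʳ k m = ℕ.*-cancelʳ-≡ _ _ (k ! ℕ.* m !) {{k !* m !≢0}} (begin
    suc m ℕ.* binom k (suc m) ℕ.* (k ! ℕ.* m !)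
      ≡⟨ solve 4 (λ m′ b k! m! → m′ :* b :* (k! :* m!) := b :* (k! :* (m′ :* m!)))
               refl (suc m) (binom k (suc m)) (k !) (m !) ⟩
    binom k (suc m) ℕ.* (k ! ℕ.* suc m !)            ≡⟨ binom-*-factorials k (suc m) ⟩
    (k ℕ.+ suc m) !                                  ≡⟨ cong _! (ℕ.+-suc k m) ⟩
    suc (k ℕ.+ m) ℕ.* (k ℕ.+ m) !                    ≡⟨ cong (suc (k ℕ.+ m) ℕ.*_) (binom-*-factorials k m) ⟨
    suc (k ℕ.+ m) ℕ.* (binom k m ℕ.* (k ! ℕ.* m !))  ≡⟨ ℕ.*-assoc (suc (k ℕ.+ m)) (binom k m) _ ⟨
    suc (k ℕ.+ m) ℕ.* binom k m ℕ.* (k ! ℕ.* m !)    ∎)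
    where
    open ≡-Reasoning
    open +-*-Solver

module _ {r₁ r₂ : Level} (R : CommutativeRing r₁ r₂) where
  open CommutativeRing R
  open import Relation.Binary.Reasoning.Setoid setoid
  open import Algebra.Properties.Semiring.Mult semiring using (_×_; ×-homo-+; ×1-homo-*)
  open import Algebra.Solver.Ring.NaturalCoefficients.Default commutativeSemiring
    using (solve; _:=_; _:+_; _:*_; con)

  ι≈×1# : ∀ n → ι R n ≈ n × 1#
  ι≈×1# zero    = refl
  ι≈×1# (suc n) = +-congˡ (ι≈×1# n)

  ι-homo-+ : ∀ m n → ι R (m ℕ.+ n) ≈ ι R m + ι R n
  ι-homo-+ m n = begin
    ι R (m ℕ.+ n)         ≈⟨ ι≈×1# (m ℕ.+ n) ⟩
    (m ℕ.+ n) × 1#        ≈⟨ ×-homo-+ 1# m n ⟩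
    m × 1# + n × 1#       ≈⟨ +-cong (ι≈×1# m) (ι≈×1# n) ⟨
    ι R m + ι R n         ∎

  ι-homo-* : ∀ m n → ι R (m ℕ.* n) ≈ ι R m * ι R n
  ι-homo-* m n = begin
    ι R (m ℕ.* n)         ≈⟨ ι≈×1# (m ℕ.* n) ⟩
    (m ℕ.* n) × 1#        ≈⟨ ×1-homo-* m n ⟩
    (m × 1#) * (n × 1#)   ≈⟨ *-cong (ι≈×1# m) (ι≈×1# n) ⟨
    ι R m * ι R n         ∎

  ι-*-cong : ∀ m n m′ n′ → m ℕ.* n ≡ m′ ℕ.* n′ → ι R m * ι R n ≈ ι R m′ * ι R n′
  ι-*-cong m n m′ n′ eq = begin
    ι R m * ι R n       ≈⟨ ι-homo-* m n ⟨
    ι R (m ℕ.* n)       ≈⟨ reflexive (≡.cong (ι R) eq) ⟩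
    ι R (m′ ℕ.* n′)     ≈⟨ ι-homo-* m′ n′ ⟩
    ι R m′ * ι R n′     ∎

  rising : Carrier → ℕ → Carrier
  rising x zero    = 1#
  rising x (suc n) = x * rising (x + 1#) n

  rising-cong : ∀ n {x y} → x ≈ y → rising x n ≈ rising y n
  rising-cong zero    x≈y = refl
  rising-cong (suc n) x≈y = *-cong x≈y (rising-cong n (+-congʳ x≈y))

  rising-sucʳ : ∀ n x → rising x (suc n) ≈ rising x n * (x + ι R n)
  rising-sucʳ zero    x = solve 1 (λ x → x :* con 1 := con 1 :* (x :+ con 0)) refl x
  rising-sucʳ (suc n) x = begin
    x * rising (x + 1#) (suc n)                   ≈⟨ *-congˡ (rising-sucʳ n (x + 1#)) ⟩
    x * (rising (x + 1#) n * ((x + 1#) + ι R n))  ≈⟨ solve 3 (λ x y n → x :* (y :* ((x :+ con 1) :+ n))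
                                                                 := x :* y :* (x :+ (con 1 :+ n)))
                                                             refl x _ (ι R n) ⟩
    x * rising (x + 1#) n * (x + ι R (suc n))     ∎

  prodFrom-cong : ∀ s n {f g} → (∀ i → f i ≈ g i) → prodFrom R s n f ≈ prodFrom R s n g
  prodFrom-cong s zero    f≈g = refl
  prodFrom-cong s (suc n) f≈g = *-cong (f≈g s) (prodFrom-cong (suc s) n f≈g)

  prodFrom-distrib-* : ∀ s n f g → prodFrom R s n (λ i → f i * g i) ≈ prodFrom R s n f * prodFrom R s n g
  prodFrom-distrib-* s zero    f g = sym (*-identityˡ 1#)
  prodFrom-distrib-* s (suc n) f g = trans (*-congˡ (prodFrom-distrib-* (suc s) n f g))
    (solve 4 (λ x y z w → (x :* y) :* (z :* w) := (x :* z) :* (y :* w)) refl (f s) (g s) _ _)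

  prodFrom-shift : ∀ s n f → prodFrom R (suc s) n f ≈ prodFrom R s n (λ i → f (suc i))
  prodFrom-shift s zero    f = refl
  prodFrom-shift s (suc n) f = *-congˡ (prodFrom-shift (suc s) n f)

  prodFrom-rising : ∀ n s x → prodFrom R s n (λ i → x + ι R i) ≈ rising (x + ι R s) n
  prodFrom-rising zero    s x = refl
  prodFrom-rising (suc n) s x = *-congˡ (trans (prodFrom-rising n (suc s) x)
    (rising-cong n (solve 2 (λ x S → x :+ (con 1 :+ S) := (x :+ S) :+ con 1) refl x (ι R s))))

  prodFrom-rising₀ : ∀ n x → prodFrom R 0 n (λ i → x + ι R i) ≈ rising x n
  prodFrom-rising₀ n x = trans (prodFrom-rising n 0 x) (rising-cong n (+-identityʳ x))

  prodFrom-falling : ∀ n s x → prodFrom R (suc s) n (λ i → (x + ι R (s ℕ.+ n)) - ι R i) ≈ rising x n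
  prodFrom-falling zero    s x = refl
  prodFrom-falling (suc n) s x rewrite ℕ.+-suc s n = begin
    ((x + ι R (suc (s ℕ.+ n))) - ι R (suc s)) * prodFrom R (suc (suc s)) n (λ i → (x + ι R (suc s ℕ.+ n)) - ι R i)
      ≈⟨ *-cong (trans (+-congʳ reorder) (//-rightDividesʳ (ι R (suc s)) (x + ι R n))) (prodFrom-falling n (suc s) x) ⟩
    (x + ι R n) * rising x n   ≈⟨ *-comm _ _ ⟩
    rising x n * (x + ι R n)   ≈⟨ rising-sucʳ n x ⟨
    rising x (suc n)           ∎
    where
    open import Algebra.Properties.Group +-group using (//-rightDividesʳ)
    reorder : x + ι R (suc (s ℕ.+ n)) ≈ (x + ι R n) + ι R (suc s)
    reorder = trans (+-congˡ (+-congˡ (ι-homo-+ s n)))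
      (solve 3 (λ x S N → x :+ (con 1 :+ (S :+ N)) := (x :+ N) :+ (con 1 :+ S)) refl x (ι R s) (ι R n))

  sumAntidiagonal : ℕ → (ℕ → ℕ → Carrier) → Carrier
  sumAntidiagonal zero    f = f 0 0
  sumAntidiagonal (suc d) f = f 0 (suc d) + sumAntidiagonal d (λ k m → f (suc k) m)

  sumAntidiagonal-cong : ∀ d {f g} → (∀ k m → k ℕ.+ m ≡ d → f k m ≈ g k m) →
                         sumAntidiagonal d f ≈ sumAntidiagonal d g
  sumAntidiagonal-cong zero    f≈g = f≈g 0 0 ≡.refl
  sumAntidiagonal-cong (suc d) f≈g =
    +-cong (f≈g 0 (suc d) ≡.refl) (sumAntidiagonal-cong d (λ k m eq → f≈g (suc k) m (≡.cong suc eq)))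

  sumAntidiagonal-distrib-+ : ∀ d f g → sumAntidiagonal d (λ k m → f k m + g k m) ≈
                                        sumAntidiagonal d f + sumAntidiagonal d g
  sumAntidiagonal-distrib-+ zero    f g = refl
  sumAntidiagonal-distrib-+ (suc d) f g = begin
    (f 0 (suc d) + g 0 (suc d)) + sumAntidiagonal d (λ k m → f (suc k) m + g (suc k) m)
      ≈⟨ +-congˡ (sumAntidiagonal-distrib-+ d _ _) ⟩
    (f 0 (suc d) + g 0 (suc d)) + (sumAntidiagonal d (λ k m → f (suc k) m) + sumAntidiagonal d (λ k m → g (suc k) m))
      ≈⟨ solve 4 (λ a b x y → (a :+ b) :+ (x :+ y) := (a :+ x) :+ (b :+ y)) refl _ _ _ _ ⟩
    sumAntidiagonal (suc d) f + sumAntidiagonal (suc d) g ∎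

  sumAntidiagonal-distribˡ-* : ∀ d x f → sumAntidiagonal d (λ k m → x * f k m) ≈ x * sumAntidiagonal d f
  sumAntidiagonal-distribˡ-* zero    x f = refl
  sumAntidiagonal-distribˡ-* (suc d) x f =
    trans (+-congˡ (sumAntidiagonal-distribˡ-* d x _)) (sym (distribˡ _ _ _))

  sumAntidiagonal-sucʳ : ∀ d f → sumAntidiagonal (suc d) f ≈
                                 sumAntidiagonal d (λ k m → f k (suc m)) + f (suc d) 0
  sumAntidiagonal-sucʳ zero    f = refl
  sumAntidiagonal-sucʳ (suc d) f =
    trans (+-congˡ (sumAntidiagonal-sucʳ d (λ k m → f (suc k) m))) (sym (+-assoc _ _ _))

  sumAntidiagonal-shift : ∀ d f → (∀ m → f 0 (suc m) ≈ 0#) → (∀ k → f (suc k) 0 ≈ 0#) →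
                          sumAntidiagonal d (λ k m → f k (suc m)) ≈ sumAntidiagonal d (λ k m → f (suc k) m)
  sumAntidiagonal-shift d f f0s≈0 fs0≈0 = begin
    sumAntidiagonal d (λ k m → f k (suc m))                ≈⟨ +-identityʳ _ ⟨
    sumAntidiagonal d (λ k m → f k (suc m)) + 0#           ≈⟨ +-congˡ (fs0≈0 d) ⟨
    sumAntidiagonal d (λ k m → f k (suc m)) + f (suc d) 0  ≈⟨ sumAntidiagonal-sucʳ d f ⟨
    f 0 (suc d) + sumAntidiagonal d (λ k m → f (suc k) m)  ≈⟨ +-congʳ (f0s≈0 d) ⟩
    0# + sumAntidiagonal d (λ k m → f (suc k) m)           ≈⟨ +-identityˡ _ ⟩
    sumAntidiagonal d (λ k m → f (suc k) m)                ∎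

  sumUpTo≈sumAntidiagonal : ∀ d g f → (∀ k m → k ℕ.+ m ≡ d → g k ≈ f k m) →
                             sumUpTo R d g ≈ sumAntidiagonal d f
  sumUpTo≈sumAntidiagonal zero    g f g≈f = g≈f 0 0 ≡.refl
  sumUpTo≈sumAntidiagonal (suc d) g f g≈f = begin
    sumUpTo R d g + g (suc d)
      ≈⟨ +-cong (sumUpTo≈sumAntidiagonal d g (λ k m → f k (suc m))
                   (λ k m eq → g≈f k (suc m) (≡.trans (ℕ.+-suc k m) (≡.cong suc eq))))
                (g≈f (suc d) 0 (ℕ.+-identityʳ (suc d))) ⟩
    sumAntidiagonal d (λ k m → f k (suc m)) + f (suc d) 0  ≈⟨ sumAntidiagonal-sucʳ d f ⟨
    sumAntidiagonal (suc d) f                             ∎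

  sumAntidiagonal-pascal : ∀ d (g : ℕ → ℕ → Carrier) →
    sumAntidiagonal (suc d) (λ k m → ι R (binom k m) * g k m) ≈
      sumAntidiagonal d (λ k m → ι R (binom k m) * g (suc k) m) +
      sumAntidiagonal d (λ k m → ι R (binom k m) * g k (suc m))
  sumAntidiagonal-pascal d g = begin
    sumAntidiagonal (suc d) (λ k m → ι R (binom k m) * g k m)
      ≈⟨ sumAntidiagonal-cong (suc d) split ⟩
    sumAntidiagonal (suc d) (λ k m → fromˡ k m + fromʳ k m)
      ≈⟨ sumAntidiagonal-distrib-+ (suc d) fromˡ fromʳ ⟩
    (0# + Σˡ) + sumAntidiagonal (suc d) fromʳ
      ≈⟨ +-cong (+-identityˡ _) (sumAntidiagonal-sucʳ d fromʳ) ⟩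
    Σˡ + (Σʳ + 0#)
      ≈⟨ +-congˡ (+-identityʳ _) ⟩
    Σˡ + Σʳ ∎
    where
    fromˡ fromʳ : ℕ → ℕ → Carrier
    fromˡ zero    m       = 0#
    fromˡ (suc k) m       = ι R (binom k m) * g (suc k) m
    fromʳ k       zero    = 0#
    fromʳ k       (suc m) = ι R (binom k m) * g k (suc m)
    Σˡ = sumAntidiagonal d (λ k m → ι R (binom k m) * g (suc k) m)
    Σʳ = sumAntidiagonal d (λ k m → ι R (binom k m) * g k (suc m))
    split : ∀ k m → k ℕ.+ m ≡ suc d → ι R (binom k m) * g k m ≈ fromˡ k m + fromʳ k m
    split zero    zero    ()
    split zero    (suc m) _ = sym (+-identityˡ _)
    split (suc k) zero    _ = trans (*-congʳ (reflexive (≡.cong (ι R) (≡.sym (binom-zeroʳ k))))) (sym (+-identityʳ _))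
    split (suc k) (suc m) _ = trans (*-congʳ (ι-homo-+ (binom k (suc m)) (binom (suc k) m))) (distribʳ _ _ _)

  module _ (p q : Carrier) where

    hyperTerm : Carrier → Carrier → ℕ → ℕ → Carrier
    hyperTerm a b k m = (rising p k * rising q k) * (rising a m * rising (b + ι R k) m)

    F : ℕ → Carrier → Carrier → Carrier
    F d a b = sumAntidiagonal d (λ k m → ι R (binom k m) * hyperTerm a b k m)

    F-cong : ∀ d {a a′ b b′} → a ≈ a′ → b ≈ b′ → F d a b ≈ F d a′ b′
    F-cong d a≈a′ b≈b′ = sumAntidiagonal-cong d λ k m _ →
      *-congˡ (*-congˡ (*-cong (rising-cong m a≈a′) (rising-cong m (+-congʳ b≈b′))))

    F-shiftᵇ : ∀ d a b → F (suc d) a (b + 1#) ≈ F (suc d) a b + (ι R (suc d) * a) * F d (a + 1#) (b + 1#)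
    F-shiftᵇ d a b = begin
      F (suc d) a (b + 1#)
        ≈⟨ sumAntidiagonal-sucʳ d (summand (b + 1#)) ⟩
      sumAntidiagonal d (λ k m → ι R (binom k (suc m)) * hyperTerm a (b + 1#) k (suc m)) + corner
        ≈⟨ +-congʳ (sumAntidiagonal-cong d λ k m k+m≡d →
             trans (shift k m) (+-congˡ (*-congʳ (*-congʳ (reflexive (≡.cong (λ n → ι R (suc n)) k+m≡d)))))) ⟩
      sumAntidiagonal d (λ k m → ι R (binom k (suc m)) * hyperTerm a b k (suc m)
                                 + scale * (ι R (binom k m) * hyperTerm (a + 1#) (b + 1#) k m)) + corner
        ≈⟨ +-congʳ (trans (sumAntidiagonal-distrib-+ d _ _) (+-congˡ (sumAntidiagonal-distribˡ-* d scale _))) ⟩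
      (Σ⁺ + scale * F d (a + 1#) (b + 1#)) + corner
        ≈⟨ solve 3 (λ x y z → (x :+ y) :+ z := (x :+ z) :+ y) refl Σ⁺ _ corner ⟩
      (Σ⁺ + corner) + scale * F d (a + 1#) (b + 1#)
        ≈⟨ +-congʳ (sumAntidiagonal-sucʳ d (summand b)) ⟨
      F (suc d) a b + scale * F d (a + 1#) (b + 1#) ∎
      where
      scale = ι R (suc d) * a
      summand : Carrier → ℕ → ℕ → Carrier
      summand b′ k m = ι R (binom k m) * hyperTerm a b′ k m
      corner = ι R (binom (suc d) 0) * hyperTerm a b (suc d) 0
      Σ⁺ = sumAntidiagonal d (λ k m → ι R (binom k (suc m)) * hyperTerm a b k (suc m))
      shift : ∀ k m → ι R (binom k (suc m)) * hyperTerm a (b + 1#) k (suc m) ≈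
                      ι R (binom k (suc m)) * hyperTerm a b k (suc m) +
                      (ι R (suc (k ℕ.+ m)) * a) * (ι R (binom k m) * hyperTerm (a + 1#) (b + 1#) k m)
      shift k m = begin
        B′ * (W * ((a * A) * rising ((b + 1#) + K) (suc m)))
          ≈⟨ *-congˡ (*-congˡ (*-congˡ (trans (rising-sucʳ m _) (*-congʳ G≈)))) ⟩
        B′ * (W * ((a * A) * (G * (((b + 1#) + K) + M))))
          ≈⟨ solve 8 (λ B′ W a A G b K M →
                  B′ :* (W :* ((a :* A) :* (G :* (((b :+ con 1) :+ K) :+ M))))
               := B′ :* (W :* ((a :* A) :* ((b :+ K) :* G))) :+ ((con 1 :+ M) :* B′) :* (a :* (W :* (A :* G))))
               refl B′ W a A G b K M ⟩
        B′ * (W * ((a * A) * ((b + K) * G))) + (ι R (suc m) * B′) * (a * (W * (A * G)))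
          ≈⟨ +-congˡ (*-congʳ (ι-*-cong (suc m) (binom k (suc m)) (suc (k ℕ.+ m)) (binom k m)
                                          (binom-absorbʳ k m))) ⟩
        B′ * (W * ((a * A) * ((b + K) * G))) + (ι R (suc (k ℕ.+ m)) * B) * (a * (W * (A * G)))
          ≈⟨ +-congˡ (solve 5 (λ S B a W X → (S :* B) :* (a :* (W :* X)) := (S :* a) :* (B :* (W :* X)))
                              refl _ B a W _) ⟩
        B′ * (W * ((a * A) * ((b + K) * G))) + (ι R (suc (k ℕ.+ m)) * a) * (B * (W * (A * G)))
          ≈⟨ +-congˡ (*-congˡ (*-congˡ (*-congˡ (*-congˡ G≈)))) ⟨
        B′ * (W * ((a * A) * ((b + K) * G))) + (ι R (suc (k ℕ.+ m)) * a) * (B * (W * (A * rising ((b + 1#) + K) m))) ∎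
        where
        B′ = ι R (binom k (suc m))
        B  = ι R (binom k m)
        W  = rising p k * rising q k
        A  = rising (a + 1#) m
        K  = ι R k
        M  = ι R m
        G  = rising ((b + K) + 1#) m
        G≈ : rising ((b + 1#) + K) m ≈ G
        G≈ = rising-cong m (solve 2 (λ b K → (b :+ con 1) :+ K := (b :+ K) :+ con 1) refl b K)

    Φ-factor : Carrier → ℕ → Carrier
    Φ-factor a n = ((a + p) + ι R n) * ((a + q) + ι R n)

    module _ (a s : Carrier) where
      private
        b : Carrier
        b = s + a + (p + q)

        B : ℕ → ℕ → Carrier
        B k m = ι R (binom k m)

        T₀ T₁ : ℕ → ℕ → Carrier
        T₀ = hyperTerm a b
        T₁ = hyperTerm (a + 1#) b

      -- Pascal's rule splits F (suc d) a b into two sums which agree with the right-hand side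
      -- of F-suc only summand by summand up to this correction; the correction telescopes.
      correction : ℕ → ℕ → Carrier
      correction k zero    = 0#
      correction k (suc m) = ι R k * (B k m * ((rising p k * rising q k) * (rising a (suc m) * rising (b + ι R k) m)))

      F-suc-summand-zero : ∀ k →
        (B k 0 * T₀ (suc k) 0 + B k 0 * T₀ k 1) + correction k 1 ≈
        (Φ-factor a (k ℕ.+ 0) * (B k 0 * T₀ k 0) + (s * a) * (B k 0 * T₁ k 0)) + correction (suc k) 0
      F-suc-summand-zero k = begin
        (B₀ * (rising p (suc k) * rising q (suc k) * (1# * 1#)) + B₀ * (W * ((a * 1#) * ((b + K) * 1#))))
          + K * (B₀ * (W * ((a * 1#) * 1#)))
          ≈⟨ +-congʳ (+-congʳ (*-congˡ (*-congʳ Wₛ))) ⟩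
        (B₀ * (P * (p + K) * (Qk * (q + K)) * (1# * 1#)) + B₀ * (W * ((a * 1#) * ((b + K) * 1#))))
          + K * (B₀ * (W * ((a * 1#) * 1#)))
          ≈⟨ solve 8 (λ B₀ P Qk p q a s K → let b = s :+ a :+ (p :+ q) in
                  (B₀ :* (P :* (p :+ K) :* (Qk :* (q :+ K)) :* (con 1 :* con 1))
                   :+ B₀ :* (P :* Qk :* ((a :* con 1) :* ((b :+ K) :* con 1))))
                  :+ K :* (B₀ :* (P :* Qk :* ((a :* con 1) :* con 1)))
               := (((a :+ p) :+ K) :* ((a :+ q) :+ K) :* (B₀ :* (P :* Qk :* (con 1 :* con 1)))
                   :+ (s :* a) :* (B₀ :* (P :* Qk :* (con 1 :* con 1))))
                  :+ con 0)
               refl B₀ P Qk p q a s K ⟩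
        (Φ-factor a k * (B₀ * (W * (1# * 1#))) + (s * a) * (B₀ * (W * (1# * 1#)))) + 0#
          ≈⟨ +-congʳ (+-congʳ (*-congʳ (reflexive (≡.cong (Φ-factor a) (≡.sym (ℕ.+-identityʳ k)))))) ⟩
        (Φ-factor a (k ℕ.+ 0) * (B₀ * (W * (1# * 1#))) + (s * a) * (B₀ * (W * (1# * 1#)))) + 0# ∎
        where
        B₀ = B k 0
        P  = rising p k
        Qk = rising q k
        W  = P * Qk
        K  = ι R k
        Wₛ : rising p (suc k) * rising q (suc k) ≈ P * (p + K) * (Qk * (q + K))
        Wₛ = *-cong (rising-sucʳ k p) (rising-sucʳ k q)

      F-suc-summand-suc : ∀ k m →
        (B k (suc m) * T₀ (suc k) (suc m) + B k (suc m) * T₀ k (suc (suc m))) + correction k (suc (suc m)) ≈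
        (Φ-factor a (k ℕ.+ suc m) * (B k (suc m) * T₀ k (suc m)) + (s * a) * (B k (suc m) * T₁ k (suc m)))
          + correction (suc k) (suc m)
      F-suc-summand-suc k m = begin
        (B′ * (rising p (suc k) * rising q (suc k) * ((a * A) * rising (b + ι R (suc k)) (suc m)))
          + B′ * (W * ((a * rising (a + 1#) (suc m)) * ((b + K) * rising ((b + K) + 1#) (suc m)))))
          + K * (B′ * (W * ((a * rising (a + 1#) (suc m)) * ((b + K) * G))))
          ≈⟨ +-cong (+-cong (*-congˡ (*-cong Wₛ (*-congˡ Gₛ′)))
                            (*-congˡ (*-congˡ (*-cong (*-congˡ Aₛ) (*-congˡ Gₛ)))))
                    (*-congˡ (*-congˡ (*-congˡ (*-congʳ (*-congˡ Aₛ))))) ⟩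
        (B′ * (P * (p + K) * (Qk * (q + K)) * ((a * A) * (G * (((b + K) + 1#) + M))))
          + B′ * (W * ((a * (A * ((a + 1#) + M))) * ((b + K) * (G * (((b + K) + 1#) + M))))))
          + K * (B′ * (W * ((a * (A * ((a + 1#) + M))) * ((b + K) * G))))
          ≈⟨ solve 11 (λ B′ P Qk p q a s K M A G → let b = s :+ a :+ (p :+ q) in
                  (B′ :* (P :* (p :+ K) :* (Qk :* (q :+ K)) :* ((a :* A) :* (G :* (((b :+ K) :+ con 1) :+ M))))
                   :+ B′ :* (P :* Qk :* ((a :* (A :* ((a :+ con 1) :+ M)))
                                           :* ((b :+ K) :* (G :* (((b :+ K) :+ con 1) :+ M))))))
                  :+ K :* (B′ :* (P :* Qk :* ((a :* (A :* ((a :+ con 1) :+ M))) :* ((b :+ K) :* G))))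
               := (((a :+ p) :+ (K :+ (con 1 :+ M))) :* ((a :+ q) :+ (K :+ (con 1 :+ M)))
                     :* (B′ :* (P :* Qk :* ((a :* A) :* ((b :+ K) :* G))))
                   :+ (s :* a) :* (B′ :* (P :* Qk :* ((A :* ((a :+ con 1) :+ M)) :* ((b :+ K) :* G)))))
                  :+ ((con 1 :+ M) :* B′) :* (P :* (p :+ K) :* (Qk :* (q :+ K)) :* ((a :* A) :* G)))
               refl B′ P Qk p q a s K M A G ⟩
        (((a + p) + (K + ι R (suc m))) * ((a + q) + (K + ι R (suc m))) * (B′ * (W * ((a * A) * ((b + K) * G))))
          + (s * a) * (B′ * (W * ((A * ((a + 1#) + M)) * ((b + K) * G)))))
          + (ι R (suc m) * B′) * (P * (p + K) * (Qk * (q + K)) * ((a * A) * G))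
          ≈⟨ +-cong (+-cong (*-congʳ Φ-factorₛ) (*-congˡ (*-congˡ (*-congˡ (*-congʳ Aₛ))))) Yₛ ⟨
        (Φ-factor a (k ℕ.+ suc m) * (B′ * T₀ k (suc m)) + (s * a) * (B′ * T₁ k (suc m)))
          + correction (suc k) (suc m) ∎
        where
        B′ = B k (suc m)
        P  = rising p k
        Qk = rising q k
        W  = P * Qk
        K  = ι R k
        M  = ι R m
        A  = rising (a + 1#) m
        G  = rising ((b + K) + 1#) m
        Wₛ : rising p (suc k) * rising q (suc k) ≈ P * (p + K) * (Qk * (q + K))
        Wₛ = *-cong (rising-sucʳ k p) (rising-sucʳ k q)
        Aₛ : rising (a + 1#) (suc m) ≈ A * ((a + 1#) + M)
        Aₛ = rising-sucʳ m (a + 1#)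
        Gₛ : rising ((b + K) + 1#) (suc m) ≈ G * (((b + K) + 1#) + M)
        Gₛ = rising-sucʳ m ((b + K) + 1#)
        b+1+K : b + ι R (suc k) ≈ (b + K) + 1#
        b+1+K = solve 2 (λ b K → b :+ (con 1 :+ K) := (b :+ K) :+ con 1) refl b K
        Gₛ′ : rising (b + ι R (suc k)) (suc m) ≈ G * (((b + K) + 1#) + M)
        Gₛ′ = trans (rising-cong (suc m) b+1+K) Gₛ
        Φ-factorₛ : Φ-factor a (k ℕ.+ suc m) ≈ ((a + p) + (K + ι R (suc m))) * ((a + q) + (K + ι R (suc m)))
        Φ-factorₛ = *-cong (+-congˡ (ι-homo-+ k (suc m))) (+-congˡ (ι-homo-+ k (suc m)))
        swap : ι R (suc k) * B (suc k) m ≈ ι R (suc m) * B′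
        swap = ι-*-cong (suc k) (binom (suc k) m) (suc m) (binom k (suc m))
                        (≡.trans (binom-absorbˡ k m) (≡.sym (binom-absorbʳ k m)))
        Yₛ : correction (suc k) (suc m) ≈ (ι R (suc m) * B′) * (P * (p + K) * (Qk * (q + K)) * ((a * A) * G))
        Yₛ = trans (sym (*-assoc _ _ _))
                   (*-cong swap (*-cong Wₛ (*-congˡ (rising-cong m b+1+K))))

      F-suc-summand : ∀ k m →
        (B k m * T₀ (suc k) m + B k m * T₀ k (suc m)) + correction k (suc m) ≈
        (Φ-factor a (k ℕ.+ m) * (B k m * T₀ k m) + (s * a) * (B k m * T₁ k m)) + correction (suc k) m
      F-suc-summand k zero    = F-suc-summand-zero k
      F-suc-summand k (suc m) = F-suc-summand-suc k m

      F-suc : ∀ d → F (suc d) a b ≈ Φ-factor a d * F d a b + (s * a) * F d (a + 1#) b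
      F-suc d = ∙-cancelʳ Σcorrection⁺ _ _ (begin
        F (suc d) a b + Σcorrection⁺
          ≈⟨ +-congʳ (sumAntidiagonal-pascal d T₀) ⟩
        (sumAntidiagonal d (λ k m → B k m * T₀ (suc k) m) + sumAntidiagonal d (λ k m → B k m * T₀ k (suc m)))
          + Σcorrection⁺
          ≈⟨ trans (sumAntidiagonal-distrib-+ d _ _) (+-congʳ (sumAntidiagonal-distrib-+ d _ _)) ⟨
        sumAntidiagonal d (λ k m → (B k m * T₀ (suc k) m + B k m * T₀ k (suc m)) + correction k (suc m))
          ≈⟨ sumAntidiagonal-cong d (λ k m k+m≡d →
               trans (F-suc-summand k m) (+-congʳ (+-congʳ (*-congʳ (reflexive (≡.cong (Φ-factor a) k+m≡d)))))) ⟩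
        sumAntidiagonal d (λ k m → (Φ-factor a d * (B k m * T₀ k m) + (s * a) * (B k m * T₁ k m)) + correction (suc k) m)
          ≈⟨ trans (sumAntidiagonal-distrib-+ d _ _) (+-congʳ (sumAntidiagonal-distrib-+ d _ _)) ⟩
        (sumAntidiagonal d (λ k m → Φ-factor a d * (B k m * T₀ k m)) +
         sumAntidiagonal d (λ k m → (s * a) * (B k m * T₁ k m))) + Σcorrection⁻
          ≈⟨ +-cong (+-cong (sumAntidiagonal-distribˡ-* d _ _) (sumAntidiagonal-distribˡ-* d _ _)) (sym telescope) ⟩
        (Φ-factor a d * F d a b + (s * a) * F d (a + 1#) b) + Σcorrection⁺ ∎)
        where
        open import Algebra.Properties.Group +-group using (∙-cancelʳ)
        Σcorrection⁺ = sumAntidiagonal d (λ k m → correction k (suc m))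
        Σcorrection⁻ = sumAntidiagonal d (λ k m → correction (suc k) m)
        telescope : Σcorrection⁺ ≈ Σcorrection⁻
        telescope = sumAntidiagonal-shift d correction (λ m → zeroˡ _) (λ k → refl)

    Φ : ℕ → Carrier → Carrier
    Φ u a = rising (a + p) u * rising (a + q) u

    Φ-sucʳ : ∀ u a → Φ (suc u) a ≈ Φ u a * Φ-factor a u
    Φ-sucʳ u a = trans (*-cong (rising-sucʳ u (a + p)) (rising-sucʳ u (a + q)))
                       (solve 4 (λ x y z w → (x :* z) :* (y :* w) := (x :* y) :* (z :* w)) refl _ _ _ _)

    Φ-sucˡ : ∀ u a → Φ (suc u) a ≈ ((a + p) * (a + q)) * Φ u (a + 1#)
    Φ-sucˡ u a = trans (*-cong (*-congˡ (rising-cong u (shift p))) (*-congˡ (rising-cong u (shift q))))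
                       (solve 4 (λ x y z w → (x :* z) :* (y :* w) := (x :* y) :* (z :* w)) refl _ _ _ _)
      where
      shift : ∀ x → (a + x) + 1# ≈ (a + 1#) + x
      shift x = solve 2 (λ a x → (a :+ x) :+ con 1 := (a :+ con 1) :+ x) refl a x

    H : ℕ → ℕ → Carrier → Carrier
    H u d a = F d a (ι R u + a + (p + q))

    H-zero-suc : ∀ d a → H 0 (suc d) a ≈ Φ-factor a d * H 0 d a
    H-zero-suc d a = trans (F-suc a 0# d) (trans (+-congˡ (trans (*-congʳ (zeroˡ a)) (zeroˡ _))) (+-identityʳ _))

    H-suc-sucᵘ : ∀ u d a → H (suc u) (suc d) a ≈ H u (suc d) a + (ι R (suc d) * a) * H u d (a + 1#)
    H-suc-sucᵘ u d a = begin
      F (suc d) a (ι R (suc u) + a + (p + q))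
        ≈⟨ F-cong (suc d) refl (solve 4 (λ U a p q → (con 1 :+ U) :+ a :+ (p :+ q) := (U :+ a :+ (p :+ q)) :+ con 1)
                                         refl (ι R u) a p q) ⟩
      F (suc d) a (ι R u + a + (p + q) + 1#)
        ≈⟨ F-shiftᵇ d a _ ⟩
      H u (suc d) a + (ι R (suc d) * a) * F d (a + 1#) (ι R u + a + (p + q) + 1#)
        ≈⟨ +-congˡ (*-congˡ (F-cong d refl (solve 4 (λ U a p q →
             (U :+ a :+ (p :+ q)) :+ con 1 := U :+ (a :+ con 1) :+ (p :+ q)) refl (ι R u) a p q))) ⟩
      H u (suc d) a + (ι R (suc d) * a) * H u d (a + 1#) ∎

    H-suc-sucᵈ : ∀ u d a → H (suc u) (suc d) a ≈ Φ-factor a d * H (suc u) d a + (ι R (suc u) * a) * H u d (a + 1#)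
    H-suc-sucᵈ u d a = trans (F-suc a (ι R (suc u)) d) (+-congˡ (*-congˡ (F-cong d refl
      (solve 4 (λ U a p q → (con 1 :+ U) :+ a :+ (p :+ q) := U :+ (a :+ con 1) :+ (p :+ q)) refl (ι R u) a p q))))

    T : ℕ → ℕ → Carrier → Carrier
    T u d a = H u d a * Φ u a

    T-suc-zero : ∀ u a → T (suc u) 0 a ≈ Φ-factor a u * T u 0 a
    T-suc-zero u a = trans (*-congˡ (Φ-sucʳ u a))
                           (solve 3 (λ h φ f → h :* (φ :* f) := f :* (h :* φ)) refl (H u 0 a) (Φ u a) (Φ-factor a u))

    T-zero-suc : ∀ d a → T 0 (suc d) a ≈ Φ-factor a d * T 0 d a
    T-zero-suc d a = trans (*-congʳ (H-zero-suc d a)) (*-assoc _ _ _)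

    T-suc-sucᵘ : ∀ u d a → T (suc u) (suc d) a ≈
                 Φ-factor a u * T u (suc d) a + ((ι R (suc d) * a) * ((a + p) * (a + q))) * T u d (a + 1#)
    T-suc-sucᵘ u d a = begin
      H (suc u) (suc d) a * Φ (suc u) a
        ≈⟨ *-congʳ (H-suc-sucᵘ u d a) ⟩
      (H u (suc d) a + c * H u d (a + 1#)) * Φ (suc u) a
        ≈⟨ distribʳ _ _ _ ⟩
      H u (suc d) a * Φ (suc u) a + (c * H u d (a + 1#)) * Φ (suc u) a
        ≈⟨ +-cong (*-congˡ (Φ-sucʳ u a)) (*-congˡ (Φ-sucˡ u a)) ⟩
      H u (suc d) a * (Φ u a * Φ-factor a u) + (c * H u d (a + 1#)) * (e * Φ u (a + 1#))
        ≈⟨ solve 7 (λ h φ f c h′ e φ′ → h :* (φ :* f) :+ (c :* h′) :* (e :* φ′)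
                                      := f :* (h :* φ) :+ (c :* e) :* (h′ :* φ′))
             refl (H u (suc d) a) (Φ u a) (Φ-factor a u) c (H u d (a + 1#)) e (Φ u (a + 1#)) ⟩
      Φ-factor a u * T u (suc d) a + (c * e) * T u d (a + 1#) ∎
      where
      c = ι R (suc d) * a
      e = (a + p) * (a + q)

    T-suc-sucᵈ : ∀ u d a → T (suc u) (suc d) a ≈
                 Φ-factor a d * T (suc u) d a + ((ι R (suc u) * a) * ((a + p) * (a + q))) * T u d (a + 1#)
    T-suc-sucᵈ u d a = begin
      H (suc u) (suc d) a * Φ (suc u) a
        ≈⟨ *-congʳ (H-suc-sucᵈ u d a) ⟩
      (Φ-factor a d * H (suc u) d a + c * H u d (a + 1#)) * Φ (suc u) a
        ≈⟨ distribʳ _ _ _ ⟩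
      (Φ-factor a d * H (suc u) d a) * Φ (suc u) a + (c * H u d (a + 1#)) * Φ (suc u) a
        ≈⟨ +-cong (*-assoc _ _ _) (*-congˡ (Φ-sucˡ u a)) ⟩
      Φ-factor a d * T (suc u) d a + (c * H u d (a + 1#)) * (e * Φ u (a + 1#))
        ≈⟨ +-congˡ (solve 4 (λ c h′ e φ′ → (c :* h′) :* (e :* φ′) := (c :* e) :* (h′ :* φ′))
                            refl c (H u d (a + 1#)) e (Φ u (a + 1#))) ⟩
      Φ-factor a d * T (suc u) d a + (c * e) * T u d (a + 1#) ∎
      where
      c = ι R (suc u) * a
      e = (a + p) * (a + q)

    T-symmetric : ∀ u d a → T u d a ≈ T d u a
    T-symmetric zero    zero    a = refl
    T-symmetric zero    (suc d) a = begin
      T 0 (suc d) a              ≈⟨ T-zero-suc d a ⟩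
      Φ-factor a d * T 0 d a     ≈⟨ *-congˡ (T-symmetric 0 d a) ⟩
      Φ-factor a d * T d 0 a     ≈⟨ T-suc-zero d a ⟨
      T (suc d) 0 a              ∎
    T-symmetric (suc u) zero    a = begin
      T (suc u) 0 a              ≈⟨ T-suc-zero u a ⟩
      Φ-factor a u * T u 0 a     ≈⟨ *-congˡ (T-symmetric u 0 a) ⟩
      Φ-factor a u * T 0 u a     ≈⟨ T-zero-suc u a ⟨
      T 0 (suc u) a              ∎
    T-symmetric (suc u) (suc d) a = begin
      T (suc u) (suc d) a
        ≈⟨ T-suc-sucᵘ u d a ⟩
      Φ-factor a u * T u (suc d) a + ((ι R (suc d) * a) * ((a + p) * (a + q))) * T u d (a + 1#)
        ≈⟨ +-cong (*-congˡ (T-symmetric u (suc d) a)) (*-congˡ (T-symmetric u d (a + 1#))) ⟩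
      Φ-factor a u * T (suc d) u a + ((ι R (suc d) * a) * ((a + p) * (a + q))) * T d u (a + 1#)
        ≈⟨ T-suc-sucᵈ d u a ⟨
      T (suc d) (suc u) a ∎

  module _ (r : Carrier) where
    open import Algebra.Properties.Group +-group using (//-rightDividesˡ)

    1-r+r≈1 : (1# - r) + r ≈ 1#
    1-r+r≈1 = //-rightDividesˡ r 1#

    Q-summand≈ : ∀ u y {d} k m → k ℕ.+ m ≡ d →
      ι R (d C k) * prodFrom R 0 k (λ i → (ι R (suc i) - r) * (ι R i + r))
        * prodIcc R (suc k) d (λ i → ((y + ι R d) + r - ι R i) * ((y + ι R u) + r + ι R i))
      ≈ ι R (binom k m) * hyperTerm (1# - r) r (y + r) (ι R u + (y + r) + ((1# - r) + r)) k m
    Q-summand≈ u y k m ≡.refl = begin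
      ι R ((k ℕ.+ m) C k) * prodFrom R 0 k lower * prodFrom R (suc k) (k ℕ.+ m ℕ.∸ k) upper
        ≈⟨ *-cong (*-cong (reflexive (≡.cong (ι R) (≡.sym (binom≡C k m)))) lower≈)
                  (trans (reflexive (≡.cong (λ n → prodFrom R (suc k) n upper) (ℕ.m+n∸m≡n k m))) upper≈) ⟩
      ι R (binom k m) * (rising (1# - r) k * rising r k) * (rising (y + r) m * rising (b + ι R k) m)
        ≈⟨ *-assoc _ _ _ ⟩
      ι R (binom k m) * hyperTerm (1# - r) r (y + r) b k m ∎
      where
      b = ι R u + (y + r) + ((1# - r) + r)
      lower upper : ℕ → Carrier
      lower i = (ι R (suc i) - r) * (ι R i + r)
      upper i = ((y + ι R (k ℕ.+ m)) + r - ι R i) * ((y + ι R u) + r + ι R i)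
      lower≈ : prodFrom R 0 k lower ≈ rising (1# - r) k * rising r k
      lower≈ = begin
        prodFrom R 0 k lower
          ≈⟨ prodFrom-cong 0 k (λ i → *-cong (solve 2 (λ I n → (con 1 :+ I) :+ n := (con 1 :+ n) :+ I)
                                                      refl (ι R i) (- r))
                                             (+-comm _ _)) ⟩
        prodFrom R 0 k (λ i → ((1# - r) + ι R i) * (r + ι R i))
          ≈⟨ prodFrom-distrib-* 0 k _ _ ⟩
        prodFrom R 0 k (λ i → (1# - r) + ι R i) * prodFrom R 0 k (λ i → r + ι R i)
          ≈⟨ *-cong (prodFrom-rising₀ k (1# - r)) (prodFrom-rising₀ k r) ⟩
        rising (1# - r) k * rising r k ∎
      upper≈ : prodFrom R (suc k) m upper ≈ rising (y + r) m * rising (b + ι R k) m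
      upper≈ = begin
        prodFrom R (suc k) m upper
          ≈⟨ prodFrom-cong (suc k) m (λ i → *-congʳ (+-congʳ
               (solve 3 (λ y D r → (y :+ D) :+ r := (y :+ r) :+ D) refl y (ι R (k ℕ.+ m)) r))) ⟩
        prodFrom R (suc k) m (λ i → (((y + r) + ι R (k ℕ.+ m)) - ι R i) * (((y + ι R u) + r) + ι R i))
          ≈⟨ prodFrom-distrib-* (suc k) m _ _ ⟩
        prodFrom R (suc k) m (λ i → ((y + r) + ι R (k ℕ.+ m)) - ι R i)
          * prodFrom R (suc k) m (λ i → ((y + ι R u) + r) + ι R i)
          ≈⟨ *-cong (prodFrom-falling m k (y + r)) (trans (prodFrom-rising m (suc k) _) (rising-cong m shift)) ⟩
        rising (y + r) m * rising (b + ι R k) m ∎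
        where
        shift : ((y + ι R u) + r) + ι R (suc k) ≈ b + ι R k
        shift = trans (solve 4 (λ y U r K → ((y :+ U) :+ r) :+ (con 1 :+ K) := ((U :+ (y :+ r)) :+ con 1) :+ K)
                               refl y (ι R u) r (ι R k))
                      (+-congʳ (+-congˡ (sym 1-r+r≈1)))

    Q≈H : ∀ u d y → Q R u d y r ≈ H (1# - r) r u d (y + r)
    Q≈H u d y = sumUpTo≈sumAntidiagonal d _ _ (Q-summand≈ u y)

    φ≈Φ : ∀ u y → φ R u y r ≈ Φ (1# - r) r u (y + r)
    φ≈Φ u y = begin
      prodFrom R 1 u (λ i → (y + ι R i) * ((y + ι R (i ℕ.∸ 1)) + (r + r)))
        ≈⟨ prodFrom-shift 0 u _ ⟩
      prodFrom R 0 u (λ i → (y + ι R (suc i)) * ((y + ι R i) + (r + r)))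
        ≈⟨ prodFrom-cong 0 u (λ i → *-cong (left i) (right i)) ⟩
      prodFrom R 0 u (λ i → (((y + r) + (1# - r)) + ι R i) * (((y + r) + r) + ι R i))
        ≈⟨ prodFrom-distrib-* 0 u _ _ ⟩
      prodFrom R 0 u (λ i → ((y + r) + (1# - r)) + ι R i) * prodFrom R 0 u (λ i → ((y + r) + r) + ι R i)
        ≈⟨ *-cong (prodFrom-rising₀ u _) (prodFrom-rising₀ u _) ⟩
      Φ (1# - r) r u (y + r) ∎
      where
      right : ∀ i → (y + ι R i) + (r + r) ≈ ((y + r) + r) + ι R i
      right i = solve 3 (λ y I r → (y :+ I) :+ (r :+ r) := ((y :+ r) :+ r) :+ I) refl y (ι R i) r
      left : ∀ i → y + ι R (suc i) ≈ ((y + r) + (1# - r)) + ι R i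
      left i = sym (trans (solve 4 (λ y r p I → ((y :+ r) :+ p) :+ I := (y :+ (p :+ r)) :+ I)
                                   refl y r (1# - r) (ι R i))
                          (trans (+-congʳ (+-congˡ 1-r+r≈1))
                                 (solve 2 (λ y I → (y :+ con 1) :+ I := y :+ (con 1 :+ I)) refl y (ι R i))))

theorem4p6 : {c ℓ : Level} (R : CommutativeRing c ℓ) (u d : ℕ) (y r : CommutativeRing.Carrier R) →
    CommutativeRing._≈_ R (CommutativeRing._*_ R (Q R u d y r) (φ R u y r))
      (CommutativeRing._*_ R (Q R d u y r) (φ R d y r))
theorem4p6 R u d y r = begin
  Q R u d y r * φ R u y r                 ≈⟨ *-cong (Q≈H R r u d y) (φ≈Φ R r u y) ⟩
  T R (1# - r) r u d (y + r)              ≈⟨ T-symmetric R (1# - r) r u d (y + r) ⟩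
  T R (1# - r) r d u (y + r)              ≈⟨ *-cong (Q≈H R r d u y) (φ≈Φ R r d y) ⟨
  Q R d u y r * φ R d y r                 ∎
  where
  open CommutativeRing R
  open import Relation.Binary.Reasoning.Setoid setoid
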